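{- Let $T$ be a tree with $n\ge 2$ vertices, and for vertices $u,v$ let $P_{u,v}$ denote the edge set of the unique path in $T$ joining $u$ and $v$. Then \[ \mathcal{V}_2^*(T^\ell,n-1)=\big\{P_{u,v}\cup\{ww : w\notin V(P_{u,v})\}\;\big|\; u,v \text{ distinct leaves of } T\big\}. \]
   Context: A tree is a finite simple connected graph without cycles. $T^\ell$ is the graph obtained from $T$ by adding a loop $ww$ at every vertex $w$. A $2$-matching of $T^\ell$ is a set $\mathcal{M}$ of edges of $T^\ell$ such that every vertex is incident to at most two of them, a loop counting twice; $|\mathcal{M}|$ is the number of edges (a loop counts once) and $\ell(\mathcal{M})$ is the set of loops in $\mathcal{M}$. $\mathcal{M}$ is minimal if there is no $2$-matching $\mathcal{M}'$ of $T^\ell$ with $\ell(\mathcal{M}')\subsetneq\ell(\mathcal{M})$ and $|\mathcal{M}'|=|\mathcal{M}|$. $\mathcal{V}_2^*(T^\ell,j)$ is the set of minimal $2$-matchings of $T^\ell$ of size $j$. -}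

module Defs where

open import Data.Nat using (ℕ; zero; suc; _+_; _*_; _≤_; _≤ᵇ_)
open import Data.Fin using (Fin; toℕ; _≟_)
open import Data.Bool using (Bool; true; false; if_then_else_; _∧_; _∨_; not)
open import Data.List using (List; []; _∷_; map; allFin; head; last; length)
open import Data.Nat.ListAction using (sum)
open import Data.Bool.ListAction using (any)
open import Data.List.Relation.Unary.Linked using (Linked)
open import Data.List.Relation.Unary.Unique.Propositional using (Unique)
open import Data.Maybe using (just)
open import Data.Product using (Σ; ∃; _×_)
open import Relation.Binary.PropositionalEquality using (_≡_; _≢_)
open import Relation.Nullary using (¬_; ⌊_⌋)

record SimpleGraph (n : ℕ) : Set where
  field
    adj    : Fin n → Fin n → Bool
    sym    : ∀ u v → adj u v ≡ adj v u
    irrefl : ∀ v → adj v v ≡ false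
open SimpleGraph public

module _ {n : ℕ} (G : SimpleGraph n) where

  Adj : Fin n → Fin n → Set
  Adj u v = adj G u v ≡ true

  IsPath : List (Fin n) → Set
  IsPath ps = Linked Adj ps × Unique ps

  PathFromTo : Fin n → Fin n → List (Fin n) → Set
  PathFromTo u v ps = IsPath ps × head ps ≡ just u × last ps ≡ just v

  Connected : Set
  Connected = ∀ u v → ∃ λ ps → PathFromTo u v ps

  IsCycle : List (Fin n) → Set
  IsCycle ps = IsPath ps × 3 ≤ length ps
             × Σ (Fin n) λ a → Σ (Fin n) λ b → head ps ≡ just a × last ps ≡ just b × Adj b a

  Acyclic : Set
  Acyclic = ∀ ps → ¬ IsCycle ps

  degree : Fin n → ℕ
  degree u = sum (map (λ v → if adj G u v then 1 else 0) (allFin n))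

  IsLeaf : Fin n → Set
  IsLeaf u = degree u ≡ 1

record Tree (n : ℕ) : Set where
  field
    graph     : SimpleGraph n
    connected : Connected graph
    acyclic   : Acyclic graph
open Tree public

-- A set of edges of T^ℓ: a symmetric Boolean matrix M; M w w = true means the loop ww
-- is in the set; M u v = true (u ≠ v) means the edge uv is in the set (must be a tree edge).
EdgeSetOf : ℕ → Set
EdgeSetOf n = Fin n → Fin n → Bool

module _ {n : ℕ} (T : Tree n) where

  IsEdgeSet : EdgeSetOf n → Set
  IsEdgeSet M = (∀ u v → M u v ≡ M v u) × (∀ u v → u ≢ v → M u v ≡ true → Adj (graph T) u v)

mdeg : {n : ℕ} → EdgeSetOf n → Fin n → ℕ
mdeg {n} M w = sum (map (λ v → if ⌊ w ≟ v ⌋ then 0 else (if M w v then 1 else 0)) (allFin n))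
             + 2 * (if M w w then 1 else 0)

msize : {n : ℕ} → EdgeSetOf n → ℕ
msize {n} M = sum (map (λ u → sum (map (λ v → if (toℕ u ≤ᵇ toℕ v) ∧ M u v then 1 else 0) (allFin n))) (allFin n))

module _ {n : ℕ} (T : Tree n) where

  Is2Matching : EdgeSetOf n → Set
  Is2Matching M = IsEdgeSet T M × (∀ w → mdeg M w ≤ 2)

  LoopsStrictSub : EdgeSetOf n → EdgeSetOf n → Set
  LoopsStrictSub M' M = (∀ w → M' w w ≡ true → M w w ≡ true)
                      × Σ (Fin n) λ w → M w w ≡ true × M' w w ≡ false

  IsMinimal2Matching : EdgeSetOf n → Set
  IsMinimal2Matching M = Is2Matching M
    × ¬ (Σ (EdgeSetOf n) λ M' → Is2Matching M' × LoopsStrictSub M' M × msize M' ≡ msize M)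

  InV2* : ℕ → EdgeSetOf n → Set
  InV2* j M = IsMinimal2Matching M × msize M ≡ j

consec : {n : ℕ} → List (Fin n) → Fin n → Fin n → Bool
consec []           a b = false
consec (x ∷ [])     a b = false
consec (x ∷ y ∷ r)  a b =
  ((⌊ x ≟ a ⌋ ∧ ⌊ y ≟ b ⌋) ∨ (⌊ x ≟ b ⌋ ∧ ⌊ y ≟ a ⌋)) ∨ consec (y ∷ r) a b

pathWithLoops : {n : ℕ} → List (Fin n) → EdgeSetOf n
pathWithLoops ps a b =
  if ⌊ a ≟ b ⌋ then not (any (λ x → ⌊ x ≟ a ⌋) ps) else consec ps a b

-- A 2-matching M of T^ℓ with n − 1 edges has degree sum 2n − 2 (a loop counting twice), so its
-- degrees fall short of 2 by a total of exactly 2. If some vertex a has degree 0, every other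
-- vertex carries a loop, since a set of unlooped vertices closed under M with all degrees 2 would
-- force a cycle in T; trading the loop of a neighbour of a for the edge to a then contradicts
-- minimality. Otherwise two vertices have degree 1; a maximal M-path from one of them ends at the
-- other, and degree counting shows that M is this path together with loops at all other vertices.
-- Minimality makes the ends leaves, for a path that can be extended trades a loop for an edge.
-- Conversely, for a path between two leaves, a 2-matching of the same size using only its loops
-- has degree at most 1 at both (unlooped) leaves, so it is again a path with loops between them,
-- and paths in a tree are unique.

module Submission where

open import Defs hiding (sym)
open import Data.Bool using (Bool; true; false; if_then_else_; _∧_; _∨_; not)
open import Data.Bool.ListAction using (any)
import Data.Bool.Properties as Bool
open import Data.Bool.Properties
  using (T-≡; ¬-not; ∨-comm; ∨-zeroʳ; ∨-identityʳ; ∧-zeroʳ; ∨-conicalʳ; not-injective; if-eta)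
open import Data.Empty using (⊥; ⊥-elim)
open import Data.Fin using (Fin; zero; suc; _≟_; toℕ)
open import Data.Fin.Properties as Fin using (toℕ-injective; any?)
open import Data.List using (List; []; _∷_; map; allFin; tabulate; length; head; last)
open import Data.List.Properties using (map-tabulate; ∷-injectiveʳ)
open import Data.List.Relation.Unary.All as All using (All; []; _∷_)
open import Data.List.Relation.Unary.AllPairs using ([]; _∷_)
open import Data.List.Relation.Unary.Linked as Linked using (Linked; []; [-]; _∷_)
open import Data.List.Relation.Unary.Unique.Propositional using (Unique)
open import Data.Maybe using (just)
open import Data.Maybe.Properties using (just-injective)
open import Data.Nat using (ℕ; zero; suc; _+_; _*_; _∸_; _≤_; _<_; _≤ᵇ_; _≤?_; z≤n; s≤s)
import Data.Nat.ListAction as ListAction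
open import Data.Nat.Properties hiding (_≟_; _≤?_)
open import Data.Nat.Tactic.RingSolver using (solve-∀)
open import Algebra.Properties.CommutativeMonoid.Sum +-0-commutativeMonoid
  using (sum; ∑-distrib-+; ∑-comm; sum-cong-≗)
open import Data.Product using (Σ; ∃; _×_; _,_; proj₁; proj₂)
open import Data.Sum using (_⊎_; inj₁; inj₂; [_,_]′)
open import Data.Unit using (⊤; tt)
open import Function using (id; _∘_)
open import Function.Bundles using (Equivalence; _⇔_; mk⇔)
open import Relation.Binary using (tri<; tri≈; tri>)
open import Relation.Binary.PropositionalEquality
open import Relation.Nullary using (¬_; Dec; ⌊_⌋; yes; no)
open import Relation.Nullary.Decidable using (isYes≗does; dec-true; dec-false; toWitness; ¬?; _×-dec_)

private variable
  n : ℕ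

-- Sums over Fin n

𝟙 : Bool → ℕ
𝟙 b = if b then 1 else 0

𝟙-injective : {a b : Bool} → 𝟙 a ≡ 𝟙 b → a ≡ b
𝟙-injective {true} {true} _ = refl
𝟙-injective {false} {false} _ = refl

δ : Fin n → Fin n → ℕ
δ i j = 𝟙 ⌊ i ≟ j ⌋

⌊≟⌋-refl : (i : Fin n) → ⌊ i ≟ i ⌋ ≡ true
⌊≟⌋-refl i = trans (isYes≗does (i ≟ i)) (dec-true (i ≟ i) refl)

⌊≟⌋-≢ : {i j : Fin n} → i ≢ j → ⌊ i ≟ j ⌋ ≡ false
⌊≟⌋-≢ {i = i} {j} i≢j = trans (isYes≗does (i ≟ j)) (dec-false (i ≟ j) i≢j)

⌊≟⌋⇒≡ : {i j : Fin n} → ⌊ i ≟ j ⌋ ≡ true → i ≡ j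
⌊≟⌋⇒≡ = toWitness ∘ Equivalence.from T-≡

δ-refl : (i : Fin n) → δ i i ≡ 1
δ-refl i = cong 𝟙 (⌊≟⌋-refl i)

δ-≢ : {i j : Fin n} → i ≢ j → δ i j ≡ 0
δ-≢ i≢j = cong 𝟙 (⌊≟⌋-≢ i≢j)

δ-sym : (i j : Fin n) → δ i j ≡ δ j i
δ-sym i j with i ≟ j
... | yes refl = sym (δ-refl i)
... | no i≢j = sym (δ-≢ (i≢j ∘ sym))

sum-allFin : (f : Fin n → ℕ) → ListAction.sum (map f (allFin n)) ≡ sum f
sum-allFin f = trans (cong ListAction.sum (map-tabulate id f)) (sum-tabulate f)
  where
  sum-tabulate : ∀ {n} (f : Fin n → ℕ) → ListAction.sum (tabulate f) ≡ sum f
  sum-tabulate {zero} f = refl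
  sum-tabulate {suc n} f = cong (f zero +_) (sum-tabulate (λ i → f (suc i)))

sum-const : (c : ℕ) → sum {n} (λ _ → c) ≡ n * c
sum-const {zero} c = refl
sum-const {suc n} c = cong (c +_) (sum-const {n} c)

sum-mono-≤ : {f g : Fin n → ℕ} → (∀ i → f i ≤ g i) → sum f ≤ sum g
sum-mono-≤ {zero} f≤g = z≤n
sum-mono-≤ {suc n} f≤g = +-mono-≤ (f≤g zero) (sum-mono-≤ (λ i → f≤g (suc i)))

≤-sum : (f : Fin n → ℕ) (i : Fin n) → f i ≤ sum f
≤-sum f zero = m≤m+n _ _
≤-sum f (suc i) = ≤-trans (≤-sum (λ j → f (suc j)) i) (m≤n+m _ _)

sum-mono-≤-≡⇒≡ : {f g : Fin n → ℕ} → (∀ i → f i ≤ g i) → sum f ≡ sum g → ∀ i → f i ≡ g i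
sum-mono-≤-≡⇒≡ {suc n} {f} {g} f≤g eq = pointwise
  where
  tail≤ : sum (λ i → f (suc i)) ≤ sum (λ i → g (suc i))
  tail≤ = sum-mono-≤ (λ i → f≤g (suc i))
  head≡ : f zero ≡ g zero
  head≡ = ≤-antisym (f≤g zero)
    (+-cancelʳ-≤ _ _ _ (≤-trans (≤-reflexive (sym eq)) (+-monoʳ-≤ (f zero) tail≤)))
  tail≡ : sum (λ i → f (suc i)) ≡ sum (λ i → g (suc i))
  tail≡ = +-cancelˡ-≡ (f zero) _ _ (trans eq (cong (_+ _) (sym head≡)))
  pointwise : ∀ i → f i ≡ g i
  pointwise zero = head≡
  pointwise (suc i) = sum-mono-≤-≡⇒≡ (λ j → f≤g (suc j)) tail≡ i

sum-zero : {f : Fin n → ℕ} → (∀ i → f i ≡ 0) → sum f ≡ 0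
sum-zero {n} f≡0 = trans (sum-cong-≗ f≡0) (trans (sum-const {n} 0) (*-zeroʳ n))

sum-single : {f : Fin n → ℕ} (a : Fin n) → (∀ i → i ≢ a → f i ≡ 0) → sum f ≡ f a
sum-single {suc n} {f} zero vanishes =
  trans (cong (f zero +_) (sum-zero {n} (λ i → vanishes (suc i) λ ()))) (+-identityʳ (f zero))
sum-single {suc n} {f} (suc a) vanishes =
  cong₂ _+_ (vanishes zero λ ()) (sum-single {n} a (λ i i≢a → vanishes (suc i) (i≢a ∘ Fin.suc-injective)))

sum-δ* : (a : Fin n) (c : Fin n → ℕ) → sum (λ i → δ i a * c i) ≡ c a
sum-δ* a c = trans (sum-single a (λ i i≢a → cong (_* c i) (δ-≢ i≢a)))
  (trans (cong (_* c a) (δ-refl a)) (+-identityʳ (c a)))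

sum-δ : (a : Fin n) → sum (λ i → δ i a) ≡ 1
sum-δ a = trans (sum-cong-≗ (λ i → sym (*-identityʳ (δ i a)))) (sum-δ* a (λ _ → 1))

-- Degrees in T^ℓ

≤ᵇ-true : {a b : ℕ} → a ≤ b → (a ≤ᵇ b) ≡ true
≤ᵇ-true = Equivalence.to T-≡ ∘ ≤⇒≤ᵇ

≤ᵇ-false : {a b : ℕ} → b < a → (a ≤ᵇ b) ≡ false
≤ᵇ-false {a} {b} b<a = ¬-not (<⇒≱ b<a ∘ ≤ᵇ⇒≤ a b ∘ Equivalence.from T-≡)

cong₃ : {A B C D : Set} (f : A → B → C → D) {a a′ : A} {b b′ : B} {c c′ : C} →
  a ≡ a′ → b ≡ b′ → c ≡ c′ → f a b c ≡ f a′ b′ c′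
cong₃ f refl refl refl = refl

SymmetricEdgeSet : EdgeSetOf n → Set
SymmetricEdgeSet M = ∀ u v → M u v ≡ M v u

nbr : EdgeSetOf n → Fin n → Fin n → ℕ
nbr M w v = if ⌊ w ≟ v ⌋ then 0 else 𝟙 (M w v)

edgeDeg : EdgeSetOf n → Fin n → ℕ
edgeDeg M w = sum (nbr M w)

nbr-≢ : (M : EdgeSetOf n) {w v : Fin n} → w ≢ v → nbr M w v ≡ 𝟙 (M w v)
nbr-≢ M {w} {v} w≢v with w ≟ v
... | yes w≡v = ⊥-elim (w≢v w≡v)
... | no _ = refl

nbr-refl : (M : EdgeSetOf n) (w : Fin n) → nbr M w w ≡ 0
nbr-refl M w with w ≟ w
... | yes _ = refl
... | no w≢w = ⊥-elim (w≢w refl)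

nbr-cong : (M M′ : EdgeSetOf n) {w v : Fin n} → M w v ≡ M′ w v → nbr M w v ≡ nbr M′ w v
nbr-cong M M′ {w} {v} = cong (λ b → if ⌊ w ≟ v ⌋ then 0 else 𝟙 b)

mdeg-split : (M : EdgeSetOf n) (w : Fin n) → mdeg M w ≡ edgeDeg M w + 2 * 𝟙 (M w w)
mdeg-split M w = cong (_+ 2 * 𝟙 (M w w)) (sum-allFin (nbr M w))

mdeg-noLoop : (M : EdgeSetOf n) (w : Fin n) → M w w ≡ false → mdeg M w ≡ edgeDeg M w
mdeg-noLoop M w noLoop = trans (mdeg-split M w) (trans (cong (λ b → edgeDeg M w + 2 * 𝟙 b) noLoop) (+-identityʳ _))

mdeg-loop : (M : EdgeSetOf n) (w : Fin n) → M w w ≡ true → mdeg M w ≡ edgeDeg M w + 2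
mdeg-loop M w loop = trans (mdeg-split M w) (cong (λ b → edgeDeg M w + 2 * 𝟙 b) loop)

mdeg≡1⇒edgeDeg≡1 : (M : EdgeSetOf n) (w : Fin n) → mdeg M w ≡ 1 → edgeDeg M w ≡ 1
mdeg≡1⇒edgeDeg≡1 M w deg≡1 = by-loop (M w w) refl
  where
  by-loop : ∀ b → M w w ≡ b → edgeDeg M w ≡ 1
  by-loop true loop = ⊥-elim (1+n≰n (subst (2 ≤_) (trans (sym (mdeg-loop M w loop)) deg≡1) (m≤n+m 2 _)))
  by-loop false no-loop = trans (sym (mdeg-noLoop M w no-loop)) deg≡1

edgeDeg≤mdeg : (M : EdgeSetOf n) (w : Fin n) → edgeDeg M w ≤ mdeg M w
edgeDeg≤mdeg M w = subst (edgeDeg M w ≤_) (sym (mdeg-split M w)) (m≤m+n _ _)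

mdeg-cong : {M M′ : EdgeSetOf n} → (∀ u v → M u v ≡ M′ u v) → ∀ w → mdeg M w ≡ mdeg M′ w
mdeg-cong {M = M} {M′} M≡M′ w = begin
  mdeg M w                       ≡⟨ mdeg-split M w ⟩
  edgeDeg M w + 2 * 𝟙 (M w w)    ≡⟨ cong₂ (λ d l → d + 2 * 𝟙 l) (sum-cong-≗ (λ v → nbr-cong M M′ (M≡M′ w v)))
                                                                 (M≡M′ w w) ⟩
  edgeDeg M′ w + 2 * 𝟙 (M′ w w)  ≡⟨ mdeg-split M′ w ⟨
  mdeg M′ w                      ∎
  where open ≡-Reasoning

upper : EdgeSetOf n → Fin n → Fin n → ℕ
upper M u v = 𝟙 ((toℕ u ≤ᵇ toℕ v) ∧ M u v)

msize-sum : (M : EdgeSetOf n) → msize M ≡ sum (λ u → sum (upper M u))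
msize-sum {n} M = trans (sum-allFin (λ u → ListAction.sum (map (upper M u) (allFin n))))
  (sum-cong-≗ (λ u → sum-allFin (upper M u)))

msize-cong : {M M′ : EdgeSetOf n} → (∀ u v → M u v ≡ M′ u v) → msize M ≡ msize M′
msize-cong {M = M} {M′} M≡M′ = trans (msize-sum M) (trans
  (sum-cong-≗ (λ u → sum-cong-≗ (λ v → cong (λ b → 𝟙 ((toℕ u ≤ᵇ toℕ v) ∧ b)) (M≡M′ u v))))
  (sym (msize-sum M′)))

upper-pair : (M : EdgeSetOf n) → SymmetricEdgeSet M → ∀ u v →
  upper M u v + upper M v u ≡ nbr M u v + δ v u * (2 * 𝟙 (M v v))
upper-pair M M-sym u v = by-cases (u ≟ v)
  where
  open ≡-Reasoning
  by-cases : Dec (u ≡ v) → upper M u v + upper M v u ≡ nbr M u v + δ v u * (2 * 𝟙 (M v v))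
  by-cases (yes refl) = begin
    upper M u u + upper M u u
      ≡⟨ cong (λ b → 𝟙 (b ∧ M u u) + 𝟙 (b ∧ M u u)) (≤ᵇ-true (≤-refl {toℕ u})) ⟩
    𝟙 (M u u) + 𝟙 (M u u)
      ≡⟨ cong (𝟙 (M u u) +_) (+-identityʳ _) ⟨
    2 * 𝟙 (M u u)
      ≡⟨ +-identityʳ _ ⟨
    2 * 𝟙 (M u u) + 0
      ≡⟨ cong₂ (λ a d → a + d * (2 * 𝟙 (M u u))) (nbr-refl M u) (δ-refl u) ⟨
    nbr M u u + δ u u * (2 * 𝟙 (M u u)) ∎
  by-cases (no u≢v) rewrite nbr-≢ M u≢v | δ-≢ (u≢v ∘ sym) | M-sym v u with <-cmp (toℕ u) (toℕ v)
  ... | tri≈ _ u≡v _ = ⊥-elim (u≢v (toℕ-injective u≡v))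
  ... | tri< u<v _ _ rewrite ≤ᵇ-true (<⇒≤ u<v) | ≤ᵇ-false u<v = refl
  ... | tri> _ _ v<u rewrite ≤ᵇ-true (<⇒≤ v<u) | ≤ᵇ-false v<u = +-comm 0 _

handshake : (M : EdgeSetOf n) → SymmetricEdgeSet M → sum (mdeg M) ≡ 2 * msize M
handshake M M-sym = sym (begin
  2 * msize M
    ≡⟨ cong (2 *_) (msize-sum M) ⟩
  2 * U
    ≡⟨ cong (U +_) (+-identityʳ U) ⟩
  U + U
    ≡⟨ cong (U +_) (∑-comm (upper M)) ⟩
  U + sum (λ u → sum (λ v → upper M v u))
    ≡⟨ ∑-distrib-+ (λ u → sum (upper M u)) _ ⟨
  sum (λ u → sum (upper M u) + sum (λ v → upper M v u))
    ≡⟨ sum-cong-≗ (λ u → ∑-distrib-+ (upper M u) _) ⟨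
  sum (λ u → sum (λ v → upper M u v + upper M v u))
    ≡⟨ sum-cong-≗ (λ u → sum-cong-≗ (upper-pair M M-sym u)) ⟩
  sum (λ u → sum (λ v → nbr M u v + δ v u * loop v))
    ≡⟨ sum-cong-≗ (λ u → ∑-distrib-+ (nbr M u) _) ⟩
  sum (λ u → edgeDeg M u + sum (λ v → δ v u * loop v))
    ≡⟨ sum-cong-≗ (λ u → cong (edgeDeg M u +_) (sum-δ* u loop)) ⟩
  sum (λ u → edgeDeg M u + loop u)
    ≡⟨ sum-cong-≗ (λ u → mdeg-split M u) ⟨
  sum (mdeg M) ∎)
  where
  open ≡-Reasoning
  U = sum (λ u → sum (upper M u))
  loop : Fin _ → ℕ
  loop v = 2 * 𝟙 (M v v)

handshake-with-ends : (M : EdgeSetOf n) → SymmetricEdgeSet M → (a b : Fin n) →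
  sum (λ w → mdeg M w + δ w a + δ w b) ≡ 2 * msize M + 1 + 1
handshake-with-ends M M-sym a b = begin
  sum (λ w → mdeg M w + δ w a + δ w b)
    ≡⟨ ∑-distrib-+ (λ w → mdeg M w + δ w a) (λ w → δ w b) ⟩
  sum (λ w → mdeg M w + δ w a) + sum (λ w → δ w b)
    ≡⟨ cong (_+ _) (∑-distrib-+ (mdeg M) (λ w → δ w a)) ⟩
  sum (mdeg M) + sum (λ w → δ w a) + sum (λ w → δ w b)
    ≡⟨ cong₃ (λ d e f → d + e + f) (handshake M M-sym) (sum-δ a) (sum-δ b) ⟩
  2 * msize M + 1 + 1 ∎
  where open ≡-Reasoning

double-pred : Fin n → 2 * (n ∸ 1) + 1 + 1 ≡ n * 2
double-pred {suc m} _ = identity m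
  where
  identity : ∀ m → 2 * m + 1 + 1 ≡ suc m * 2
  identity = solve-∀

-- Paths as edge sets of T^ℓ

false≢true : false ≢ true
false≢true ()

∨-true⁻ : (a b : Bool) → a ∨ b ≡ true → a ≡ true ⊎ b ≡ true
∨-true⁻ true _ _ = inj₁ refl
∨-true⁻ false _ b≡true = inj₂ b≡true

∧-true⁻ : (a b : Bool) → a ∧ b ≡ true → a ≡ true × b ≡ true
∧-true⁻ true _ b≡true = refl , b≡true

_∈ᵇ_ : Fin n → List (Fin n) → Bool
w ∈ᵇ ps = any (λ x → ⌊ x ≟ w ⌋) ps

∈ᵇ-here : (x : Fin n) (xs : List (Fin n)) → x ∈ᵇ (x ∷ xs) ≡ true
∈ᵇ-here x xs = cong (_∨ (x ∈ᵇ xs)) (⌊≟⌋-refl x)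

∈ᵇ-there : {a : Fin n} (x : Fin n) (xs : List (Fin n)) → a ∈ᵇ xs ≡ true → a ∈ᵇ (x ∷ xs) ≡ true
∈ᵇ-there {a = a} x _ a∈xs = trans (cong (⌊ x ≟ a ⌋ ∨_) a∈xs) (∨-zeroʳ _)

∈ᵇ-∷-≢ : {a x : Fin n} (xs : List (Fin n)) → x ≢ a → a ∈ᵇ (x ∷ xs) ≡ a ∈ᵇ xs
∈ᵇ-∷-≢ {a = a} xs x≢a = cong (_∨ (a ∈ᵇ xs)) (⌊≟⌋-≢ x≢a)

∉ᵇ-∈ᵇ⇒≢ : {a b : Fin n} (xs : List (Fin n)) → a ∈ᵇ xs ≡ false → b ∈ᵇ xs ≡ true → a ≢ b
∉ᵇ-∈ᵇ⇒≢ _ a∉xs b∈xs refl = false≢true (trans (sym a∉xs) b∈xs)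

All≢⇒∉ᵇ : {a : Fin n} {xs : List (Fin n)} → All (a ≢_) xs → a ∈ᵇ xs ≡ false
All≢⇒∉ᵇ [] = refl
All≢⇒∉ᵇ {xs = _ ∷ xs} (a≢x ∷ a∉xs) = trans (∈ᵇ-∷-≢ xs (a≢x ∘ sym)) (All≢⇒∉ᵇ a∉xs)

∉ᵇ⇒All≢ : {a : Fin n} (xs : List (Fin n)) → a ∈ᵇ xs ≡ false → All (a ≢_) xs
∉ᵇ⇒All≢ [] _ = []
∉ᵇ⇒All≢ (x ∷ xs) a∉x∷xs = a≢x ∷ ∉ᵇ⇒All≢ xs (trans (sym (∈ᵇ-∷-≢ xs (a≢x ∘ sym))) a∉x∷xs)
  where
  a≢x = ∉ᵇ-∈ᵇ⇒≢ (x ∷ xs) a∉x∷xs (∈ᵇ-here x xs)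

Unique⇒head∉ᵇ : {x : Fin n} {xs : List (Fin n)} → Unique (x ∷ xs) → x ∈ᵇ xs ≡ false
Unique⇒head∉ᵇ (x≢xs ∷ _) = All≢⇒∉ᵇ x≢xs

lastOf : Fin n → List (Fin n) → Fin n
lastOf x [] = x
lastOf _ (y ∷ ys) = lastOf y ys

last-∷ : (x : Fin n) (xs : List (Fin n)) → last (x ∷ xs) ≡ just (lastOf x xs)
last-∷ x [] = refl
last-∷ x (y ∷ ys) = last-∷ y ys

lastOf-∈ᵇ : (x : Fin n) (xs : List (Fin n)) → lastOf x xs ∈ᵇ (x ∷ xs) ≡ true
lastOf-∈ᵇ x [] = ∈ᵇ-here x []
lastOf-∈ᵇ x (y ∷ ys) = ∈ᵇ-there x (y ∷ ys) (lastOf-∈ᵇ y ys)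

start≢end : {x y : Fin n} (ys : List (Fin n)) → Unique (x ∷ y ∷ ys) → x ≢ lastOf y ys
start≢end ys unique = ∉ᵇ-∈ᵇ⇒≢ (_ ∷ ys) (Unique⇒head∉ᵇ unique) (lastOf-∈ᵇ _ ys)

consec-sym : (ps : List (Fin n)) (a b : Fin n) → consec ps a b ≡ consec ps b a
consec-sym [] a b = refl
consec-sym (x ∷ []) a b = refl
consec-sym (x ∷ y ∷ r) a b =
  cong₂ _∨_ (∨-comm (⌊ x ≟ a ⌋ ∧ ⌊ y ≟ b ⌋) (⌊ x ≟ b ⌋ ∧ ⌊ y ≟ a ⌋)) (consec-sym (y ∷ r) a b)

consec-∷-true : {x y a b : Fin n} (r : List (Fin n)) → consec (x ∷ y ∷ r) a b ≡ true →
  (x ≡ a × y ≡ b) ⊎ (x ≡ b × y ≡ a) ⊎ consec (y ∷ r) a b ≡ true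
consec-∷-true {x = x} {y} {a} {b} r xy∈
  with ∨-true⁻ ((⌊ x ≟ a ⌋ ∧ ⌊ y ≟ b ⌋) ∨ (⌊ x ≟ b ⌋ ∧ ⌊ y ≟ a ⌋)) (consec (y ∷ r) a b) xy∈
... | inj₂ yr∈ = inj₂ (inj₂ yr∈)
... | inj₁ xy≡ab with ∨-true⁻ (⌊ x ≟ a ⌋ ∧ ⌊ y ≟ b ⌋) (⌊ x ≟ b ⌋ ∧ ⌊ y ≟ a ⌋) xy≡ab
...   | inj₁ ab with ∧-true⁻ ⌊ x ≟ a ⌋ ⌊ y ≟ b ⌋ ab
...     | x≡a , y≡b = inj₁ (⌊≟⌋⇒≡ x≡a , ⌊≟⌋⇒≡ y≡b)
consec-∷-true {x = x} {y} {a} {b} r xy∈ | inj₁ _ | inj₂ ba with ∧-true⁻ ⌊ x ≟ b ⌋ ⌊ y ≟ a ⌋ ba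
...     | x≡b , y≡a = inj₂ (inj₁ (⌊≟⌋⇒≡ x≡b , ⌊≟⌋⇒≡ y≡a))

consec⇒∈ᵇ : (ps : List (Fin n)) {a b : Fin n} → consec ps a b ≡ true → a ∈ᵇ ps ≡ true
consec⇒∈ᵇ (x ∷ y ∷ r) {a} {b} ab∈ =
  [ head-edge , [ head-edge-reversed , ∈ᵇ-there x (y ∷ r) ∘ consec⇒∈ᵇ (y ∷ r) ]′ ]′ (consec-∷-true r ab∈)
  where
  head-edge : x ≡ a × y ≡ b → a ∈ᵇ (x ∷ y ∷ r) ≡ true
  head-edge (refl , _) = ∈ᵇ-here x (y ∷ r)
  head-edge-reversed : x ≡ b × y ≡ a → a ∈ᵇ (x ∷ y ∷ r) ≡ true
  head-edge-reversed (_ , refl) = ∈ᵇ-there x (y ∷ r) (∈ᵇ-here y r)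

consec-∉ᵇ : (ps : List (Fin n)) {a b : Fin n} → a ∈ᵇ ps ≡ false → consec ps a b ≡ false
consec-∉ᵇ ps a∉ps = ¬-not (λ ab∈ → false≢true (trans (sym a∉ps) (consec⇒∈ᵇ ps ab∈)))

consec⇒related : {R : Fin n → Fin n → Set} → (∀ {a b} → R a b → R b a) →
  {ps : List (Fin n)} → Linked R ps → ∀ {a b} → consec ps a b ≡ true → R a b
consec⇒related R-sym (_∷_ {x = x} {y = y} {xs = r} Rxy linked) {a} {b} ab∈
  with consec-∷-true {x = x} {y} {a} {b} r ab∈
... | inj₁ (refl , refl) = Rxy
... | inj₂ (inj₁ (refl , refl)) = R-sym Rxy
... | inj₂ (inj₂ ab∈r) = consec⇒related R-sym linked ab∈r

consec-from-head : {x y : Fin n} (ys : List (Fin n)) → x ∈ᵇ (y ∷ ys) ≡ false →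
  ∀ v → consec (x ∷ y ∷ ys) x v ≡ ⌊ y ≟ v ⌋
consec-from-head {x = x} {y} ys x∉ v = begin
  ((⌊ x ≟ x ⌋ ∧ ⌊ y ≟ v ⌋) ∨ (⌊ x ≟ v ⌋ ∧ ⌊ y ≟ x ⌋)) ∨ consec (y ∷ ys) x v
    ≡⟨ cong₃ (λ p q r → ((p ∧ ⌊ y ≟ v ⌋) ∨ (⌊ x ≟ v ⌋ ∧ q)) ∨ r)
         (⌊≟⌋-refl x) (⌊≟⌋-≢ (x≢y ∘ sym)) (consec-∉ᵇ (y ∷ ys) x∉) ⟩
  (⌊ y ≟ v ⌋ ∨ (⌊ x ≟ v ⌋ ∧ false)) ∨ false
    ≡⟨ ∨-identityʳ _ ⟩
  ⌊ y ≟ v ⌋ ∨ (⌊ x ≟ v ⌋ ∧ false)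
    ≡⟨ cong (⌊ y ≟ v ⌋ ∨_) (∧-zeroʳ _) ⟩
  ⌊ y ≟ v ⌋ ∨ false
    ≡⟨ ∨-identityʳ _ ⟩
  ⌊ y ≟ v ⌋ ∎
  where
  open ≡-Reasoning
  x≢y = ∉ᵇ-∈ᵇ⇒≢ (y ∷ ys) x∉ (∈ᵇ-here y ys)

consec-off-head : {x y w : Fin n} (ys : List (Fin n)) → x ≢ w →
  ∀ v → consec (x ∷ y ∷ ys) w v ≡ (⌊ x ≟ v ⌋ ∧ ⌊ y ≟ w ⌋) ∨ consec (y ∷ ys) w v
consec-off-head {x = x} {y} {w} ys x≢w v =
  cong (λ p → ((p ∧ ⌊ y ≟ v ⌋) ∨ (⌊ x ≟ v ⌋ ∧ ⌊ y ≟ w ⌋)) ∨ consec (y ∷ ys) w v) (⌊≟⌋-≢ x≢w)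

edgeDeg-consec-head : {x y : Fin n} (ys : List (Fin n)) → x ∈ᵇ (y ∷ ys) ≡ false →
  edgeDeg (consec (x ∷ y ∷ ys)) x ≡ 1
edgeDeg-consec-head {x = x} {y} ys x∉ = trans (sum-cong-≗ (λ v → nbr≡δ v (x ≟ v))) (sum-δ y)
  where
  nbr≡δ : ∀ v → Dec (x ≡ v) → nbr (consec (x ∷ y ∷ ys)) x v ≡ δ v y
  nbr≡δ v (yes refl) =
    trans (nbr-refl (consec (x ∷ y ∷ ys)) x) (sym (δ-≢ (∉ᵇ-∈ᵇ⇒≢ (y ∷ ys) x∉ (∈ᵇ-here y ys))))
  nbr≡δ v (no x≢v) =
    trans (nbr-≢ (consec (x ∷ y ∷ ys)) x≢v) (trans (cong 𝟙 (consec-from-head ys x∉ v)) (δ-sym y v))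

edgeDeg-consec-∷ : {x y w : Fin n} (ys : List (Fin n)) → x ∈ᵇ (y ∷ ys) ≡ false → x ≢ w →
  edgeDeg (consec (x ∷ y ∷ ys)) w ≡ δ y w + edgeDeg (consec (y ∷ ys)) w
edgeDeg-consec-∷ {x = x} {y} {w} ys x∉ x≢w = begin
  edgeDeg (consec (x ∷ y ∷ ys)) w
    ≡⟨ sum-cong-≗ (λ v → nbr-split v (x ≟ v)) ⟩
  sum (λ v → δ v x * δ y w + nbr (consec (y ∷ ys)) w v)
    ≡⟨ ∑-distrib-+ (λ v → δ v x * δ y w) _ ⟩
  sum (λ v → δ v x * δ y w) + edgeDeg (consec (y ∷ ys)) w
    ≡⟨ cong (_+ _) (sum-δ* x (λ _ → δ y w)) ⟩
  δ y w + edgeDeg (consec (y ∷ ys)) w ∎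
  where
  open ≡-Reasoning
  nbr-split : ∀ v → Dec (x ≡ v) → nbr (consec (x ∷ y ∷ ys)) w v ≡ δ v x * δ y w + nbr (consec (y ∷ ys)) w v
  nbr-split v (yes refl) = begin
    nbr (consec (x ∷ y ∷ ys)) w x
      ≡⟨ nbr-≢ (consec (x ∷ y ∷ ys)) (x≢w ∘ sym) ⟩
    𝟙 (consec (x ∷ y ∷ ys) w x)
      ≡⟨ cong 𝟙 (consec-off-head ys x≢w x) ⟩
    𝟙 ((⌊ x ≟ x ⌋ ∧ ⌊ y ≟ w ⌋) ∨ consec (y ∷ ys) w x)
      ≡⟨ cong₂ (λ p q → 𝟙 ((p ∧ ⌊ y ≟ w ⌋) ∨ q)) (⌊≟⌋-refl x) wx∉ ⟩
    𝟙 (⌊ y ≟ w ⌋ ∨ false)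
      ≡⟨ cong 𝟙 (∨-identityʳ _) ⟩
    δ y w
      ≡⟨ +-identityʳ _ ⟨
    δ y w + 𝟙 false
      ≡⟨ cong₂ _+_ (*-identityˡ _) (trans (nbr-≢ (consec (y ∷ ys)) (x≢w ∘ sym)) (cong 𝟙 wx∉)) ⟨
    1 * δ y w + nbr (consec (y ∷ ys)) w x
      ≡⟨ cong (λ d → d * δ y w + nbr (consec (y ∷ ys)) w x) (δ-refl x) ⟨
    δ x x * δ y w + nbr (consec (y ∷ ys)) w x ∎
    where
    wx∉ : consec (y ∷ ys) w x ≡ false
    wx∉ = trans (consec-sym (y ∷ ys) w x) (consec-∉ᵇ (y ∷ ys) x∉)
  nbr-split v (no x≢v) = begin
    nbr (consec (x ∷ y ∷ ys)) w v
      ≡⟨ nbr-cong (consec (x ∷ y ∷ ys)) (consec (y ∷ ys)) (trans (consec-off-head ys x≢w v)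
           (cong (λ p → (p ∧ ⌊ y ≟ w ⌋) ∨ consec (y ∷ ys) w v) (⌊≟⌋-≢ x≢v))) ⟩
    nbr (consec (y ∷ ys)) w v
      ≡⟨ cong (λ d → d * δ y w + nbr (consec (y ∷ ys)) w v) (δ-≢ (x≢v ∘ sym)) ⟨
    δ v x * δ y w + nbr (consec (y ∷ ys)) w v ∎

consec-degree : (x : Fin n) (xs : List (Fin n)) → Unique (x ∷ xs) → ∀ w →
  edgeDeg (consec (x ∷ xs)) w + δ w x + δ w (lastOf x xs) ≡ 2 * 𝟙 (w ∈ᵇ (x ∷ xs))
consec-degree x [] _ w = begin
  edgeDeg (consec (x ∷ [])) w + δ w x + δ w x
    ≡⟨ cong (λ d → d + δ w x + δ w x) (sum-zero (λ v → if-eta ⌊ w ≟ v ⌋)) ⟩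
  δ w x + δ w x
    ≡⟨ cong₂ _+_ (δ-sym w x) (trans (δ-sym w x) (sym (+-identityʳ _))) ⟩
  2 * δ x w
    ≡⟨ cong (λ b → 2 * 𝟙 b) (∨-identityʳ ⌊ x ≟ w ⌋) ⟨
  2 * 𝟙 (w ∈ᵇ (x ∷ [])) ∎
  where open ≡-Reasoning
consec-degree x (y ∷ ys) (x∉ys ∷ y∷ys-unique) w = by-cases (x ≟ w)
  where
  open ≡-Reasoning
  l = lastOf y ys
  x∉ = All≢⇒∉ᵇ x∉ys
  by-cases : Dec (x ≡ w) → edgeDeg (consec (x ∷ y ∷ ys)) w + δ w x + δ w l ≡ 2 * 𝟙 (w ∈ᵇ (x ∷ y ∷ ys))
  by-cases (yes refl) = begin
    edgeDeg (consec (x ∷ y ∷ ys)) x + δ x x + δ x l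
      ≡⟨ cong₃ (λ d e f → d + e + f) (edgeDeg-consec-head ys x∉) (δ-refl x) (δ-≢ x≢l) ⟩
    2
      ≡⟨ cong (λ b → 2 * 𝟙 b) (∈ᵇ-here x (y ∷ ys)) ⟨
    2 * 𝟙 (x ∈ᵇ (x ∷ y ∷ ys)) ∎
    where
    x≢l = ∉ᵇ-∈ᵇ⇒≢ (y ∷ ys) x∉ (lastOf-∈ᵇ y ys)
  by-cases (no x≢w) = begin
    edgeDeg (consec (x ∷ y ∷ ys)) w + δ w x + δ w l
      ≡⟨ cong₂ (λ d e → d + e + δ w l) (edgeDeg-consec-∷ ys x∉ x≢w) (δ-≢ (x≢w ∘ sym)) ⟩
    δ y w + edgeDeg (consec (y ∷ ys)) w + 0 + δ w l
      ≡⟨ cong (_+ δ w l) (trans (+-identityʳ _) (+-comm (δ y w) _)) ⟩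
    edgeDeg (consec (y ∷ ys)) w + δ y w + δ w l
      ≡⟨ cong (λ d → edgeDeg (consec (y ∷ ys)) w + d + δ w l) (δ-sym y w) ⟩
    edgeDeg (consec (y ∷ ys)) w + δ w y + δ w l
      ≡⟨ consec-degree y ys y∷ys-unique w ⟩
    2 * 𝟙 (w ∈ᵇ (y ∷ ys))
      ≡⟨ cong (λ b → 2 * 𝟙 b) (∈ᵇ-∷-≢ (y ∷ ys) x≢w) ⟨
    2 * 𝟙 (w ∈ᵇ (x ∷ y ∷ ys)) ∎

pathWithLoops-loop : (ps : List (Fin n)) (w : Fin n) → pathWithLoops ps w w ≡ not (w ∈ᵇ ps)
pathWithLoops-loop ps w = cong (λ b → if b then not (w ∈ᵇ ps) else consec ps w w) (⌊≟⌋-refl w)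

pathWithLoops-≢ : (ps : List (Fin n)) {w v : Fin n} → w ≢ v → pathWithLoops ps w v ≡ consec ps w v
pathWithLoops-≢ ps {w} {v} w≢v = cong (λ b → if b then not (w ∈ᵇ ps) else consec ps w v) (⌊≟⌋-≢ w≢v)

pathWithLoops-sym : (ps : List (Fin n)) → SymmetricEdgeSet (pathWithLoops ps)
pathWithLoops-sym ps u v with u ≟ v
... | yes refl = sym (pathWithLoops-loop ps u)
... | no u≢v = trans (consec-sym ps u v) (sym (pathWithLoops-≢ ps (u≢v ∘ sym)))

nbr-pathWithLoops : (ps : List (Fin n)) (w v : Fin n) → nbr (pathWithLoops ps) w v ≡ nbr (consec ps) w v
nbr-pathWithLoops ps w v with w ≟ v
... | yes _ = refl
... | no _ = refl

𝟙-not : (b : Bool) → 𝟙 b + 𝟙 (not b) ≡ 1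
𝟙-not true = refl
𝟙-not false = refl

mdeg-pathWithLoops : (x : Fin n) (xs : List (Fin n)) → Unique (x ∷ xs) → ∀ w →
  mdeg (pathWithLoops (x ∷ xs)) w + δ w x + δ w (lastOf x xs) ≡ 2
mdeg-pathWithLoops x xs unique w = begin
  mdeg P w + δ w x + δ w l                        ≡⟨ cong (λ d → d + δ w x + δ w l) (mdeg-split P w) ⟩
  edgeDeg P w + 2 * 𝟙 (P w w) + δ w x + δ w l     ≡⟨ cong₂ (λ d b → d + 2 * 𝟙 b + δ w x + δ w l)
                                                       (sum-cong-≗ (nbr-pathWithLoops ps w)) (pathWithLoops-loop ps w) ⟩
  E + 2 * 𝟙 (not b) + δ w x + δ w l               ≡⟨ rearrange E (2 * 𝟙 (not b)) (δ w x) (δ w l) ⟩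
  (E + δ w x + δ w l) + 2 * 𝟙 (not b)             ≡⟨ cong (_+ 2 * 𝟙 (not b)) (consec-degree x xs unique w) ⟩
  2 * 𝟙 b + 2 * 𝟙 (not b)                         ≡⟨ *-distribˡ-+ 2 (𝟙 b) (𝟙 (not b)) ⟨
  2 * (𝟙 b + 𝟙 (not b))                           ≡⟨ cong (2 *_) (𝟙-not b) ⟩
  2                                               ∎
  where
  open ≡-Reasoning
  ps = x ∷ xs
  P = pathWithLoops ps
  l = lastOf x xs
  E = edgeDeg (consec ps) w
  b = w ∈ᵇ ps
  rearrange : ∀ a p q r → a + p + q + r ≡ a + q + r + p
  rearrange = solve-∀

mdeg-pathWithLoops-inner : (x : Fin n) (xs : List (Fin n)) → Unique (x ∷ xs) → ∀ {w} → w ≢ x → w ≢ lastOf x xs →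
  mdeg (pathWithLoops (x ∷ xs)) w ≡ 2
mdeg-pathWithLoops-inner x xs unique {w} w≢x w≢l = begin
  mdeg P w                                 ≡⟨ +-identityʳ _ ⟨
  mdeg P w + 0                             ≡⟨ +-identityʳ _ ⟨
  mdeg P w + 0 + 0                         ≡⟨ cong₂ (λ d e → mdeg P w + d + e) (δ-≢ w≢x) (δ-≢ w≢l) ⟨
  mdeg P w + δ w x + δ w (lastOf x xs)     ≡⟨ mdeg-pathWithLoops x xs unique w ⟩
  2                                        ∎
  where
  open ≡-Reasoning
  P = pathWithLoops (x ∷ xs)

mdeg-pathWithLoops-start : (x y : Fin n) (ys : List (Fin n)) → Unique (x ∷ y ∷ ys) →
  mdeg (pathWithLoops (x ∷ y ∷ ys)) x ≡ 1
mdeg-pathWithLoops-start x y ys unique = +-cancelʳ-≡ 1 _ _ (begin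
  mdeg P x + 1
    ≡⟨ +-identityʳ _ ⟨
  mdeg P x + 1 + 0
    ≡⟨ cong₂ (λ d e → mdeg P x + d + e) (δ-refl x) (δ-≢ (start≢end ys unique)) ⟨
  mdeg P x + δ x x + δ x (lastOf y ys)
    ≡⟨ mdeg-pathWithLoops x (y ∷ ys) unique x ⟩
  2 ∎)
  where
  open ≡-Reasoning
  P = pathWithLoops (x ∷ y ∷ ys)

msize-pathWithLoops : (x : Fin n) (xs : List (Fin n)) → Unique (x ∷ xs) → msize (pathWithLoops (x ∷ xs)) ≡ n ∸ 1
msize-pathWithLoops {n} x xs unique =
  *-cancelˡ-≡ (msize P) (n ∸ 1) 2 (+-cancelʳ-≡ 1 _ _ (+-cancelʳ-≡ 1 _ _ (begin
    2 * msize P + 1 + 1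
      ≡⟨ handshake-with-ends P (pathWithLoops-sym (x ∷ xs)) x (lastOf x xs) ⟨
    sum (λ w → mdeg P w + δ w x + δ w l)
      ≡⟨ sum-cong-≗ (mdeg-pathWithLoops x xs unique) ⟩
    sum {n} (λ _ → 2)
      ≡⟨ sum-const {n} 2 ⟩
    n * 2
      ≡⟨ double-pred x ⟨
    2 * (n ∸ 1) + 1 + 1 ∎)))
  where
  open ≡-Reasoning
  P = pathWithLoops (x ∷ xs)
  l = lastOf x xs

-- Paths in trees

takeThrough : Fin n → List (Fin n) → List (Fin n)
takeThrough y [] = []
takeThrough y (x ∷ xs) = if ⌊ x ≟ y ⌋ then x ∷ [] else x ∷ takeThrough y xs

module _ (y : Fin n) where

  lastOf-takeThrough : (d : Fin n) (xs : List (Fin n)) → y ∈ᵇ xs ≡ true → lastOf d (takeThrough y xs) ≡ y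
  lastOf-takeThrough d (x ∷ xs) y∈xs with x ≟ y
  ... | yes x≡y = x≡y
  ... | no _ = lastOf-takeThrough x xs y∈xs

  takeThrough-nonempty : (xs : List (Fin n)) → y ∈ᵇ xs ≡ true → 1 ≤ length (takeThrough y xs)
  takeThrough-nonempty (x ∷ xs) _ with ⌊ x ≟ y ⌋
  ... | true = s≤s z≤n
  ... | false = s≤s z≤n

  takeThrough-Linked : {R : Fin n → Fin n → Set} (d : Fin n) (xs : List (Fin n)) →
    Linked R (d ∷ xs) → Linked R (d ∷ takeThrough y xs)
  takeThrough-Linked d [] linked = linked
  takeThrough-Linked d (x ∷ xs) (Rdx ∷ linked) with ⌊ x ≟ y ⌋
  ... | true = Rdx ∷ [-]
  ... | false = Rdx ∷ takeThrough-Linked x xs linked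

  takeThrough-All : {P : Fin n → Set} (xs : List (Fin n)) → All P xs → All P (takeThrough y xs)
  takeThrough-All [] all = all
  takeThrough-All (x ∷ xs) (px ∷ all) with ⌊ x ≟ y ⌋
  ... | true = px ∷ []
  ... | false = px ∷ takeThrough-All xs all

  takeThrough-Unique : (xs : List (Fin n)) → Unique xs → Unique (takeThrough y xs)
  takeThrough-Unique [] unique = unique
  takeThrough-Unique (x ∷ xs) (x∉xs ∷ unique) with ⌊ x ≟ y ⌋
  ... | true = [] ∷ []
  ... | false = takeThrough-All xs x∉xs ∷ takeThrough-Unique xs unique

module _ (G : SimpleGraph n) where

  Adj-sym : {a b : Fin n} → Adj G a b → Adj G b a
  Adj-sym {a} {b} = trans (SimpleGraph.sym G b a)

  Adj-irrefl : {a b : Fin n} → Adj G a b → a ≢ b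
  Adj-irrefl {a} Aaa refl with () ← trans (sym (SimpleGraph.irrefl G a)) Aaa

module _ (T : Tree n) where

  private
    G = graph T

  -- otherwise the path from z through p to y, closed by the edge yz, would be a cycle
  neighbour-of-start-∉ᵇ : {z p y : Fin n} (rest : List (Fin n)) → IsPath G (z ∷ p ∷ rest) →
    Adj G z y → y ≢ p → y ∈ᵇ (z ∷ p ∷ rest) ≡ false
  neighbour-of-start-∉ᵇ {z = z} {p} {y} rest (Azp ∷ linked , z∉ ∷ unique) Azy y≢p = ¬-not y∉
    where
    y∉ : y ∈ᵇ (z ∷ p ∷ rest) ≢ true
    y∉ y∈ = acyclic T cycle (cycle-IsPath , cycle-length , z , y , refl , cycle-last , Adj-sym G Azy)
      where
      y∈rest : y ∈ᵇ rest ≡ true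
      y∈rest = trans (sym (trans (∈ᵇ-∷-≢ (p ∷ rest) (Adj-irrefl G Azy)) (∈ᵇ-∷-≢ rest (y≢p ∘ sym)))) y∈
      arc = takeThrough y (p ∷ rest)
      cycle = z ∷ arc
      cycle-IsPath : IsPath G cycle
      cycle-IsPath = takeThrough-Linked y z (p ∷ rest) (Azp ∷ linked)
                   , takeThrough-All y (p ∷ rest) z∉ ∷ takeThrough-Unique y (p ∷ rest) unique
      arc≡ : arc ≡ p ∷ takeThrough y rest
      arc≡ = cong (λ b → if b then p ∷ [] else p ∷ takeThrough y rest) (⌊≟⌋-≢ (y≢p ∘ sym))
      cycle-length : 3 ≤ length cycle
      cycle-length = subst (λ c → 3 ≤ length (z ∷ c)) (sym arc≡) (s≤s (s≤s (takeThrough-nonempty y rest y∈rest)))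
      cycle-last : last cycle ≡ just y
      cycle-last = trans (last-∷ z arc) (cong just (lastOf-takeThrough y z (p ∷ rest) (∈ᵇ-there p rest y∈rest)))

  private
    PathTo : List (Fin n) → Set
    PathTo qs = ∀ ps → IsPath G ps → IsPath G qs → head ps ≡ head qs → last ps ≡ last qs → ps ≡ qs

    -- if the second vertices differ, prepending q to the first path gives a second path q ⇝ end
    -- through x, so by the induction hypothesis x would occur twice in x ∷ q ∷ qr
    path-unique-∷ : {x p q : Fin n} (pr qr : List (Fin n)) → IsPath G (x ∷ p ∷ pr) → IsPath G (x ∷ q ∷ qr) →
      last (p ∷ pr) ≡ last (q ∷ qr) → PathTo (q ∷ qr) → x ∷ p ∷ pr ≡ x ∷ q ∷ qr
    path-unique-∷ {x} {p} {q} pr qr ps-path@(Axp ∷ ps-linked , _ ∷ ps-unique) (Axq ∷ qs-linked , x∉qs ∷ qs-unique)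
      same-end ih = by-cases (p ≟ q)
      where
      by-cases : Dec (p ≡ q) → x ∷ p ∷ pr ≡ x ∷ q ∷ qr
      by-cases (yes refl) = cong (x ∷_) (ih (p ∷ pr) (ps-linked , ps-unique) (qs-linked , qs-unique) refl same-end)
      by-cases (no p≢q) = ⊥-elim (∉ᵇ-∈ᵇ⇒≢ (q ∷ qr) (All≢⇒∉ᵇ x∉qs) x∈qs refl)
        where
        q∉ps = neighbour-of-start-∉ᵇ pr ps-path Axq (p≢q ∘ sym)
        detour : q ∷ x ∷ p ∷ pr ≡ q ∷ qr
        detour = ih (q ∷ x ∷ p ∷ pr)
          (Adj-sym G Axq ∷ Axp ∷ ps-linked , ∉ᵇ⇒All≢ (x ∷ p ∷ pr) q∉ps ∷ proj₂ ps-path)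
          (qs-linked , qs-unique) refl same-end
        x∈qs : x ∈ᵇ (q ∷ qr) ≡ true
        x∈qs = subst (λ l → x ∈ᵇ (q ∷ l) ≡ true) (∷-injectiveʳ detour)
          (∈ᵇ-there q (x ∷ p ∷ pr) (∈ᵇ-here x (p ∷ pr)))

  path-unique : (qs : List (Fin n)) → PathTo qs
  path-unique [] [] _ _ _ _ = refl
  path-unique (x ∷ []) (.x ∷ []) _ _ refl _ = refl
  path-unique (x ∷ []) (.x ∷ y ∷ ys) (_ , unique) _ refl same-end =
    ⊥-elim (start≢end ys unique (sym (just-injective (trans (sym (last-∷ y ys)) same-end))))
  path-unique (x ∷ y ∷ ys) (.x ∷ []) _ (_ , unique) refl same-end =
    ⊥-elim (start≢end ys unique (just-injective (trans same-end (last-∷ y ys))))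
  path-unique (x ∷ q ∷ qr) (.x ∷ p ∷ pr) ps-path qs-path refl same-end =
    path-unique-∷ pr qr ps-path qs-path same-end (path-unique (q ∷ qr))

-- Maximal paths in an edge set of a tree

sum-∈ᵇ : (xs : List (Fin n)) → Unique xs → sum (λ w → 𝟙 (w ∈ᵇ xs)) ≡ length xs
sum-∈ᵇ {n} [] _ = sum-zero {n} (λ _ → refl)
sum-∈ᵇ (x ∷ xs) unique@(_ ∷ xs-unique) = begin
  sum (λ w → 𝟙 (w ∈ᵇ (x ∷ xs)))                ≡⟨ sum-cong-≗ (λ w → split w (x ≟ w)) ⟩
  sum (λ w → δ w x + 𝟙 (w ∈ᵇ xs))              ≡⟨ ∑-distrib-+ (λ w → δ w x) _ ⟩
  sum (λ w → δ w x) + sum (λ w → 𝟙 (w ∈ᵇ xs))  ≡⟨ cong₂ _+_ (sum-δ x) (sum-∈ᵇ xs xs-unique) ⟩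
  suc (length xs)                              ∎
  where
  open ≡-Reasoning
  split : ∀ w → Dec (x ≡ w) → 𝟙 (w ∈ᵇ (x ∷ xs)) ≡ δ w x + 𝟙 (w ∈ᵇ xs)
  split w (yes refl) =
    trans (cong 𝟙 (∈ᵇ-here x xs)) (sym (cong₂ _+_ (δ-refl x) (cong 𝟙 (Unique⇒head∉ᵇ unique))))
  split w (no x≢w) = trans (cong 𝟙 (∈ᵇ-∷-≢ xs x≢w)) (cong (_+ 𝟙 (w ∈ᵇ xs)) (sym (δ-≢ (x≢w ∘ sym))))

Unique⇒length≤ : (xs : List (Fin n)) → Unique xs → length xs ≤ n
Unique⇒length≤ {n} xs unique = begin
  length xs                     ≡⟨ sum-∈ᵇ xs unique ⟨
  sum (λ w → 𝟙 (w ∈ᵇ xs))       ≤⟨ sum-mono-≤ (λ w → 𝟙≤1 (w ∈ᵇ xs)) ⟩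
  sum {n} (λ _ → 1)             ≡⟨ trans (sum-const {n} 1) (*-identityʳ n) ⟩
  n                             ∎
  where
  open ≤-Reasoning
  𝟙≤1 : ∀ b → 𝟙 b ≤ 1
  𝟙≤1 true = s≤s z≤n
  𝟙≤1 false = z≤n

Edge : EdgeSetOf n → Fin n → Fin n → Set
Edge M u v = M u v ≡ true

module _ (M : EdgeSetOf n) where

  edgeDeg-pos : {w v : Fin n} → w ≢ v → Edge M w v → 1 ≤ edgeDeg M w
  edgeDeg-pos {w} {v} w≢v Mwv = ≤-trans (≤-reflexive (sym (trans (nbr-≢ M w≢v) (cong 𝟙 Mwv)))) (≤-sum (nbr M w) v)

  edgeDeg≡0⇒no-edge : {w v : Fin n} → edgeDeg M w ≡ 0 → w ≢ v → M w v ≡ false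
  edgeDeg≡0⇒no-edge deg≡0 w≢v = ¬-not (λ Mwv → 1+n≰n (subst (1 ≤_) deg≡0 (edgeDeg-pos w≢v Mwv)))

  edgeDeg≤1 : {z p : Fin n} → (∀ y → y ≢ z → Edge M z y → y ≡ p) → edgeDeg M z ≤ 1
  edgeDeg≤1 {z} {p} only-p = ≤-trans (sum-mono-≤ nbr≤δ) (≤-reflexive (sum-δ p))
    where
    nbr≤δ : ∀ y → nbr M z y ≤ δ y p
    nbr≤δ y with z ≟ y
    ... | yes _ = z≤n
    ... | no z≢y with M z y in Mzy
    ...   | false = z≤n
    ...   | true rewrite only-p y (z≢y ∘ sym) Mzy | δ-refl p = ≤-refl

  neighbour : {z : Fin n} → 1 ≤ edgeDeg M z → ∃ λ y → y ≢ z × Edge M z y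
  neighbour {z} 1≤deg with any? (λ y → ¬? (y ≟ z) ×-dec (M z y Bool.≟ true))
  ... | yes found = found
  ... | no none = ⊥-elim (1+n≰n (subst (1 ≤_) (sum-zero nbr≡0) 1≤deg))
    where
    nbr≡0 : ∀ y → nbr M z y ≡ 0
    nbr≡0 y with z ≟ y
    ... | yes _ = refl
    ... | no z≢y with M z y in Mzy
    ...   | false = refl
    ...   | true = ⊥-elim (none (y , z≢y ∘ sym , Mzy))

  other-neighbour? : (z p : Fin n) →
    (∃ λ y → y ≢ z × y ≢ p × Edge M z y) ⊎ (∀ y → y ≢ z → Edge M z y → y ≡ p)
  other-neighbour? z p with any? (λ y → ¬? (y ≟ z) ×-dec (¬? (y ≟ p) ×-dec (M z y Bool.≟ true)))
  ... | yes found = inj₁ found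
  ... | no none = inj₂ only-p
    where
    only-p : ∀ y → y ≢ z → Edge M z y → y ≡ p
    only-p y y≢z Mzy with y ≟ p
    ... | yes y≡p = y≡p
    ... | no y≢p = ⊥-elim (none (y , y≢z , y≢p , Mzy))

  neighbour-≢ : {z : Fin n} → 2 ≤ edgeDeg M z → ∀ p → ∃ λ y → y ≢ z × y ≢ p × Edge M z y
  neighbour-≢ {z} 2≤deg p with other-neighbour? z p
  ... | inj₁ found = found
  ... | inj₂ only-p = ⊥-elim (1+n≰n (≤-trans 2≤deg (edgeDeg≤1 only-p)))

nbr-mono : {M M′ : EdgeSetOf n} {w : Fin n} → (∀ {v} → w ≢ v → Edge M w v → Edge M′ w v) →
  ∀ v → nbr M w v ≤ nbr M′ w v
nbr-mono {M = M} {w = w} ⊆M′ v with w ≟ v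
... | yes _ = z≤n
... | no w≢v with M w v in Mwv
...   | false = z≤n
...   | true rewrite ⊆M′ w≢v Mwv = ≤-refl

ClosedUnder : EdgeSetOf n → (Fin n → Set) → Set
ClosedUnder M P = ∀ {u v} → P u → u ≢ v → Edge M u v → P v

module _ (T : Tree n) {M : EdgeSetOf n} (M-edges : IsEdgeSet T M) where

  private
    G = graph T

  Edge-sym : {u v : Fin n} → Edge M u v → Edge M v u
  Edge-sym {u} {v} = trans (proj₁ M-edges v u)

  Edge⇒Adj : {u v : Fin n} → u ≢ v → Edge M u v → Adj G u v
  Edge⇒Adj = proj₂ M-edges _ _

  Linked-Edge⇒Adj : {xs : List (Fin n)} → Linked (Edge M) xs → Unique xs → Linked (Adj G) xs
  Linked-Edge⇒Adj [] _ = []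
  Linked-Edge⇒Adj [-] _ = [-]
  Linked-Edge⇒Adj (Mxy ∷ linked) ((x≢y ∷ _) ∷ unique) = Edge⇒Adj x≢y Mxy ∷ Linked-Edge⇒Adj linked unique

  record StuckPath (P : Fin n → Set) (a : Fin n) : Set where
    constructor stuckPath
    field
      start next : Fin n
      rest : List (Fin n)
      linked : Linked (Edge M) (start ∷ next ∷ rest)
      unique : Unique (start ∷ next ∷ rest)
      all-P : All P (start ∷ next ∷ rest)
      ends-at : lastOf start (next ∷ rest) ≡ a
      stuck : ∀ y → y ≢ start → Edge M start y → y ≡ next

  private
    -- a path has at most n vertices, so n extension steps suffice
    extend-within : {P : Fin n → Set} → ClosedUnder M P → (fuel : ℕ) {z p : Fin n} (rest : List (Fin n)) →
      n < length (z ∷ p ∷ rest) + fuel →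
      Linked (Edge M) (z ∷ p ∷ rest) → Unique (z ∷ p ∷ rest) → All P (z ∷ p ∷ rest) →
      StuckPath P (lastOf z (p ∷ rest))
    extend-within {P} closed fuel {z} {p} rest bound linked unique all-P with other-neighbour? M z p
    ... | inj₂ only-p = stuckPath z p rest linked unique all-P refl only-p
    ... | inj₁ (y , y≢z , y≢p , Mzy) = extend fuel bound
      where
      y∉ = neighbour-of-start-∉ᵇ T rest (Linked-Edge⇒Adj linked unique , unique) (Edge⇒Adj (y≢z ∘ sym) Mzy) y≢p
      unique′ : Unique (y ∷ z ∷ p ∷ rest)
      unique′ = ∉ᵇ⇒All≢ (z ∷ p ∷ rest) y∉ ∷ unique
      extend : ∀ fuel → n < length (z ∷ p ∷ rest) + fuel → StuckPath P (lastOf z (p ∷ rest))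
      extend zero bound =
        ⊥-elim (<⇒≱ (subst (n <_) (+-identityʳ _) bound) (<⇒≤ (Unique⇒length≤ (y ∷ z ∷ p ∷ rest) unique′)))
      extend (suc fuel) bound = extend-within closed fuel (p ∷ rest) (subst (n <_) (+-suc _ fuel) bound)
        (Edge-sym Mzy ∷ linked) unique′ (closed (All.head all-P) (y≢z ∘ sym) Mzy ∷ all-P)

  extend-until-stuck : {P : Fin n → Set} → ClosedUnder M P → {z p : Fin n} (rest : List (Fin n)) →
    Linked (Edge M) (z ∷ p ∷ rest) → Unique (z ∷ p ∷ rest) → All P (z ∷ p ∷ rest) →
    StuckPath P (lastOf z (p ∷ rest))
  extend-until-stuck closed rest = extend-within closed n rest (s≤s (m≤n+m n (suc (length rest))))

  edge-path : {u v : Fin n} → u ≢ v → Edge M u v → Linked (Edge M) (v ∷ u ∷ []) × Unique (v ∷ u ∷ [])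
  edge-path u≢v Muv = Edge-sym Muv ∷ [-] , ((u≢v ∘ sym) ∷ []) ∷ [] ∷ []

  -- in a forest, a maximal path ends in a vertex of degree at most 1
  no-closed-set-of-degree-≥2 : {P : Fin n → Set} → ClosedUnder M P → (∀ {u} → P u → 2 ≤ edgeDeg M u) →
    ∀ w → ¬ P w
  no-closed-set-of-degree-≥2 {P} closed 2≤deg w Pw with neighbour-≢ M (2≤deg Pw) w
  ... | y , y≢w , _ , Mwy with edge-path (y≢w ∘ sym) Mwy
  ...   | linked , unique with extend-until-stuck closed [] linked unique (closed Pw (y≢w ∘ sym) Mwy ∷ Pw ∷ [])
  ...     | stuckPath start next _ _ _ (P-start ∷ _) _ stuck with neighbour-≢ M (2≤deg P-start) next
  ...       | y′ , y′≢start , y′≢next , M-start-y′ = y′≢next (stuck y′ y′≢start M-start-y′)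

-- 2-matchings with n − 1 edges

module _ (T : Tree n) {M : EdgeSetOf n} (M-matching : Is2Matching T M) where

  private
    M-edges = proj₁ M-matching
    mdeg≤2 = proj₂ M-matching

  no-loop-at-edge : {w : Fin n} → 1 ≤ edgeDeg M w → M w w ≡ false
  no-loop-at-edge {w} 1≤deg with M w w in Mww
  ... | false = refl
  ... | true = ⊥-elim (<⇒≱ (+-monoˡ-≤ 2 1≤deg) (subst (_≤ 2) (mdeg-loop M w Mww) (mdeg≤2 w)))

  no-edge-at-loop : {w : Fin n} → M w w ≡ true → edgeDeg M w ≡ 0
  no-edge-at-loop {w} Mww = n≤0⇒n≡0 (+-cancelʳ-≤ 2 _ _ (subst (_≤ 2) (mdeg-loop M w Mww) (mdeg≤2 w)))

  module _ {x : Fin n} {xs : List (Fin n)} (linked : Linked (Edge M) (x ∷ xs)) (unique : Unique (x ∷ xs))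
           (same-deg : ∀ w → mdeg M w ≡ mdeg (pathWithLoops (x ∷ xs)) w) where

    private
      ps = x ∷ xs
      P = pathWithLoops ps

    nbr-pathWithLoops≤nbr : ∀ w v → nbr P w v ≤ nbr M w v
    nbr-pathWithLoops≤nbr w v = subst (_≤ nbr M w v) (sym (nbr-pathWithLoops ps w v))
      (nbr-mono {M = consec ps} {M} {w} (λ _ → consec⇒related (Edge-sym T M-edges) linked) v)

    -- on the path, M already uses its whole degree on the path edges
    agrees-on-path : ∀ {w} → w ∈ᵇ ps ≡ true → M w w ≡ false × (∀ v → w ≢ v → M w v ≡ P w v)
    agrees-on-path {w} w∈ps = unlooped , λ v w≢v → 𝟙-injective (trans (sym (nbr-≢ M w≢v))
      (trans (sym (sum-mono-≤-≡⇒≡ (nbr-pathWithLoops≤nbr w) (sym deg-M≡deg-P) v)) (nbr-≢ P w≢v)))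
      where
      mdeg-P : mdeg P w ≡ edgeDeg P w
      mdeg-P = mdeg-noLoop P w (trans (pathWithLoops-loop ps w) (cong not w∈ps))
      deg-P≤deg-M : edgeDeg P w ≤ edgeDeg M w
      deg-P≤deg-M = sum-mono-≤ (nbr-pathWithLoops≤nbr w)
      mdeg-M≤deg-M : mdeg M w ≤ edgeDeg M w
      mdeg-M≤deg-M = ≤-trans (≤-reflexive (trans (same-deg w) mdeg-P)) deg-P≤deg-M
      deg-M≡deg-P : edgeDeg M w ≡ edgeDeg P w
      deg-M≡deg-P = ≤-antisym (≤-trans (edgeDeg≤mdeg M w) (≤-reflexive (trans (same-deg w) mdeg-P))) deg-P≤deg-M
      unlooped : M w w ≡ false
      unlooped = ¬-not (λ Mww → m+1+n≰m (edgeDeg M w) (subst (_≤ edgeDeg M w) (mdeg-loop M w Mww) mdeg-M≤deg-M))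

    looped-off-path : ∀ {w} → w ∈ᵇ ps ≡ false → M w w ≡ true
    looped-off-path {w} w∉ps with M w w in Mww
    ... | true = refl
    ... | false = ⊥-elim (no-closed-set-of-degree-≥2 T M-edges closed 2≤deg w (w∉ps , Mww))
      where
      Unlooped : Fin n → Set
      Unlooped u = u ∈ᵇ ps ≡ false × M u u ≡ false
      -- an M-edge from u to a path vertex v would be a path edge at v, putting u on the path
      closed : ClosedUnder M Unlooped
      closed {u} {v} (u∉ps , _) u≢v Muv = v∉ps , no-loop-at-edge (edgeDeg-pos M (u≢v ∘ sym) (Edge-sym T M-edges Muv))
        where
        v∉ps : v ∈ᵇ ps ≡ false
        v∉ps = ¬-not λ v∈ps → false≢true (trans (sym u∉ps) (consec⇒∈ᵇ ps (trans (consec-sym ps u v)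
          (trans (sym (pathWithLoops-≢ ps (u≢v ∘ sym))) (trans (sym (proj₂ (agrees-on-path v∈ps) u (u≢v ∘ sym)))
            (Edge-sym T M-edges Muv))))))
      2≤deg : ∀ {u} → Unlooped u → 2 ≤ edgeDeg M u
      2≤deg {u} (u∉ps , unlooped) = ≤-reflexive (sym (begin
        edgeDeg M u   ≡⟨ mdeg-noLoop M u unlooped ⟨
        mdeg M u      ≡⟨ same-deg u ⟩
        mdeg P u      ≡⟨ mdeg-pathWithLoops-inner x xs unique (∉ᵇ-∈ᵇ⇒≢ ps u∉ps (∈ᵇ-here x xs))
                           (∉ᵇ-∈ᵇ⇒≢ ps u∉ps (lastOf-∈ᵇ x xs)) ⟩
        2             ∎))
        where open ≡-Reasoning

    pathWithLoops-rigid : ∀ u v → M u v ≡ P u v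
    pathWithLoops-rigid u v = by-cases (u ∈ᵇ ps) refl (u ≟ v)
      where
      loop≡ : ∀ {b} → u ∈ᵇ ps ≡ b → P u u ≡ not b
      loop≡ u∈? = trans (pathWithLoops-loop ps u) (cong not u∈?)
      by-cases : (b : Bool) → u ∈ᵇ ps ≡ b → Dec (u ≡ v) → M u v ≡ P u v
      by-cases true u∈ps (yes refl) = trans (proj₁ (agrees-on-path u∈ps)) (sym (loop≡ u∈ps))
      by-cases true u∈ps (no u≢v) = proj₂ (agrees-on-path u∈ps) v u≢v
      by-cases false u∉ps (yes refl) = trans (looped-off-path u∉ps) (sym (loop≡ u∉ps))
      by-cases false u∉ps (no u≢v) = trans (edgeDeg≡0⇒no-edge M (no-edge-at-loop (looped-off-path u∉ps)) u≢v)
                                          (sym (trans (pathWithLoops-≢ ps u≢v) (consec-∉ᵇ ps u∉ps)))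

  module _ (size : msize M ≡ n ∸ 1) where

    -- the degrees sum to 2n − 2, so a deficit of 2 at a and b leaves every vertex with degree exactly 2
    deficit-forced : (a b : Fin n) → (∀ w → mdeg M w + δ w a + δ w b ≤ 2) → ∀ w → mdeg M w + δ w a + δ w b ≡ 2
    deficit-forced a b bounded = sum-mono-≤-≡⇒≡ bounded (begin
      sum (λ w → mdeg M w + δ w a + δ w b)                    ≡⟨ handshake-with-ends M (proj₁ M-edges) a b ⟩
      2 * msize M + 1 + 1                                     ≡⟨ cong (λ s → 2 * s + 1 + 1) size ⟩
      2 * (n ∸ 1) + 1 + 1                                     ≡⟨ double-pred a ⟩
      n * 2                                                   ≡⟨ sum-const {n} 2 ⟨
      sum {n} (λ _ → 2)                                       ∎)
      where open ≡-Reasoning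

    private
      δ-away : (w : Fin n) {a b : Fin n} → w ≢ a → w ≢ b → mdeg M w + δ w a + δ w b ≡ mdeg M w
      δ-away w w≢a w≢b =
        trans (cong₂ (λ d e → mdeg M w + d + e) (δ-≢ w≢a) (δ-≢ w≢b)) (trans (+-identityʳ _) (+-identityʳ _))

    degrees-at-two-pendants : {a b : Fin n} → a ≢ b → mdeg M a ≡ 1 → mdeg M b ≡ 1 →
      ∀ w → mdeg M w + δ w a + δ w b ≡ 2
    degrees-at-two-pendants {a} {b} a≢b deg-a deg-b = deficit-forced a b (λ w → bounded w (w ≟ a) (w ≟ b))
      where
      bounded : ∀ w → Dec (w ≡ a) → Dec (w ≡ b) → mdeg M w + δ w a + δ w b ≤ 2
      bounded w (yes refl) _ = ≤-reflexive (cong₃ (λ d e f → d + e + f) deg-a (δ-refl a) (δ-≢ a≢b))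
      bounded w (no _) (yes refl) = ≤-reflexive (cong₃ (λ d e f → d + e + f) deg-b (δ-≢ (a≢b ∘ sym)) (δ-refl b))
      bounded w (no w≢a) (no w≢b) = subst (_≤ 2) (sym (δ-away w w≢a w≢b)) (mdeg≤2 w)

    degrees-at-isolated : {a : Fin n} → mdeg M a ≡ 0 → ∀ w → w ≢ a → mdeg M w ≡ 2
    degrees-at-isolated {a} deg-a w w≢a =
      trans (sym (δ-away w w≢a w≢a)) (deficit-forced a a (λ w → bounded w (w ≟ a)) w)
      where
      bounded : ∀ w → Dec (w ≡ a) → mdeg M w + δ w a + δ w a ≤ 2
      bounded w (yes refl) = ≤-reflexive (cong₃ (λ d e f → d + e + f) deg-a (δ-refl a) (δ-refl a))
      bounded w (no w≢a) = subst (_≤ 2) (sym (δ-away w w≢a w≢a)) (mdeg≤2 w)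

    isolated⇒single-vertex-path : {a : Fin n} → mdeg M a ≡ 0 → ∀ u v → M u v ≡ pathWithLoops (a ∷ []) u v
    isolated⇒single-vertex-path {a} deg-a u v = by-cases (u ≟ v)
      where
      a-unlooped : M a a ≡ false
      a-unlooped = ¬-not (λ Maa → n≮0 (subst (2 ≤_) (trans (sym (mdeg-loop M a Maa)) deg-a) (m≤n+m 2 _)))
      Unlooped : Fin n → Set
      Unlooped w = w ≢ a × M w w ≡ false
      closed : ClosedUnder M Unlooped
      closed (u≢a , _) u≢v Muv = v≢a , no-loop-at-edge 1≤deg-v
        where
        1≤deg-v = edgeDeg-pos M (u≢v ∘ sym) (Edge-sym T M-edges Muv)
        v≢a : _ ≢ a
        v≢a refl = 1+n≰n (subst (1 ≤_) deg-a (≤-trans 1≤deg-v (edgeDeg≤mdeg M a)))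
      2≤deg : ∀ {w} → Unlooped w → 2 ≤ edgeDeg M w
      2≤deg {w} (w≢a , unlooped) =
        ≤-reflexive (sym (trans (sym (mdeg-noLoop M w unlooped)) (degrees-at-isolated deg-a w w≢a)))
      looped : ∀ {w} → w ≢ a → M w w ≡ true
      looped {w} w≢a with M w w in Mww
      ... | true = refl
      ... | false = ⊥-elim (no-closed-set-of-degree-≥2 T M-edges closed 2≤deg w (w≢a , Mww))
      edgeless : ∀ w → edgeDeg M w ≡ 0
      edgeless w with w ≟ a
      ... | yes refl = n≤0⇒n≡0 (subst (edgeDeg M a ≤_) deg-a (edgeDeg≤mdeg M a))
      ... | no w≢a = no-edge-at-loop (looped w≢a)
      by-cases : Dec (u ≡ v) → M u v ≡ pathWithLoops (a ∷ []) u v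
      by-cases (no u≢v) = trans (edgeDeg≡0⇒no-edge M (edgeless u) u≢v) (sym (pathWithLoops-≢ (a ∷ []) u≢v))
      by-cases (yes refl) = trans (loop (a ≟ u)) (sym (pathWithLoops-loop (a ∷ []) u))
        where
        loop : Dec (a ≡ u) → M u u ≡ not (u ∈ᵇ (a ∷ []))
        loop (yes refl) = trans a-unlooped (cong not (sym (∈ᵇ-here a [])))
        loop (no a≢u) = trans (looped (a≢u ∘ sym)) (cong not (sym (∈ᵇ-∷-≢ [] a≢u)))

    record PendantPath (a : Fin n) : Set where
      constructor pendantPath
      field
        start next : Fin n
        rest : List (Fin n)
        is-path : IsPath (graph T) (start ∷ next ∷ rest)
        ends-at : lastOf start (next ∷ rest) ≡ a
        agrees : ∀ u v → M u v ≡ pathWithLoops (start ∷ next ∷ rest) u v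

    -- walk from a along M until stuck; the two ends then carry the whole deficit
    pendant⇒path : {a : Fin n} → mdeg M a ≡ 1 → PendantPath a
    pendant⇒path {a} deg-a with neighbour M (≤-reflexive (sym (mdeg≡1⇒edgeDeg≡1 M a deg-a)))
    ... | q , q≢a , Maq with edge-path T M-edges (q≢a ∘ sym) Maq
    ...   | linked , unique
            with extend-until-stuck T M-edges {P = λ _ → ⊤} (λ _ _ _ → tt) [] linked unique (tt ∷ tt ∷ [])
    ...     | stuckPath z p rest linked′ unique′ _ z⇝a stuck =
      pendantPath z p rest (Linked-Edge⇒Adj T M-edges linked′ unique′ , unique′) z⇝a
        (pathWithLoops-rigid linked′ unique′ same-deg)
      where
      z≢a : z ≢ a
      z≢a = subst (z ≢_) z⇝a (start≢end rest unique′)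
      z≢p : z ≢ p
      z≢p = ∉ᵇ-∈ᵇ⇒≢ (p ∷ rest) (Unique⇒head∉ᵇ unique′) (∈ᵇ-here p rest)
      edgeDeg-z : edgeDeg M z ≡ 1
      edgeDeg-z = ≤-antisym (edgeDeg≤1 M stuck) (edgeDeg-pos M z≢p (Linked.head linked′))
      deg-z : mdeg M z ≡ 1
      deg-z = trans (mdeg-noLoop M z (no-loop-at-edge (≤-reflexive (sym edgeDeg-z)))) edgeDeg-z
      same-deg : ∀ w → mdeg M w ≡ mdeg (pathWithLoops (z ∷ p ∷ rest)) w
      same-deg w = +-cancelʳ-≡ (δ w z) _ _ (+-cancelʳ-≡ (δ w a) _ _ (trans (degrees-at-two-pendants z≢a deg-z deg-a w)
        (sym (subst (λ l → mdeg (pathWithLoops (z ∷ p ∷ rest)) w + δ w z + δ w l ≡ 2) z⇝a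
          (mdeg-pathWithLoops z (p ∷ rest) unique′ w)))))

-- Minimal 2-matchings with n − 1 edges

vertex-of : 2 ≤ n → Fin n
vertex-of (s≤s _) = zero

other-vertex : 2 ≤ n → (a : Fin n) → ∃ λ b → b ≢ a
other-vertex (s≤s (s≤s _)) zero = suc zero , λ ()
other-vertex (s≤s (s≤s _)) (suc a) = zero , λ ()

module _ (T : Tree n) where

  private
    G = graph T

  pathWithLoops-2matching : {x : Fin n} {xs : List (Fin n)} → IsPath G (x ∷ xs) → Is2Matching T (pathWithLoops (x ∷ xs))
  pathWithLoops-2matching {x} {xs} (linked , unique) = (pathWithLoops-sym (x ∷ xs) , path-edges) , mdeg≤2
    where
    path-edges : ∀ u v → u ≢ v → pathWithLoops (x ∷ xs) u v ≡ true → Adj G u v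
    path-edges u v u≢v uv∈ = consec⇒related (Adj-sym G) linked (trans (sym (pathWithLoops-≢ (x ∷ xs) u≢v)) uv∈)
    mdeg≤2 : ∀ w → mdeg (pathWithLoops (x ∷ xs)) w ≤ 2
    mdeg≤2 w = subst (mdeg (pathWithLoops (x ∷ xs)) w ≤_) (mdeg-pathWithLoops x xs unique w)
      (≤-trans (m≤m+n _ (δ w x)) (m≤m+n _ (δ w (lastOf x xs))))

  -- prepending a vertex to the path trades the loop at that vertex for an edge
  extendable⇒not-minimal : {M : EdgeSetOf n} {x y : Fin n} {ys : List (Fin n)} →
    (∀ u v → M u v ≡ pathWithLoops (y ∷ ys) u v) → IsPath G (x ∷ y ∷ ys) → ¬ IsMinimal2Matching T M
  extendable⇒not-minimal {M} {x} {y} {ys} agrees path@(_ ∷ linked , x∉ ∷ unique) (_ , minimal) =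
    minimal (pathWithLoops (x ∷ y ∷ ys) , pathWithLoops-2matching path , (fewer , x , Mxx , M′xx) , same-size)
    where
    fewer : ∀ w → pathWithLoops (x ∷ y ∷ ys) w w ≡ true → M w w ≡ true
    fewer w M′ww = trans (agrees w w) (trans (pathWithLoops-loop (y ∷ ys) w) (cong not
      (∨-conicalʳ ⌊ x ≟ w ⌋ (w ∈ᵇ (y ∷ ys))
        (not-injective (trans (sym (pathWithLoops-loop (x ∷ y ∷ ys) w)) M′ww)))))
    Mxx : M x x ≡ true
    Mxx = trans (agrees x x) (trans (pathWithLoops-loop (y ∷ ys) x) (cong not (All≢⇒∉ᵇ x∉)))
    M′xx : pathWithLoops (x ∷ y ∷ ys) x x ≡ false
    M′xx = trans (pathWithLoops-loop (x ∷ y ∷ ys) x) (cong not (∈ᵇ-here x (y ∷ ys)))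
    same-size : msize (pathWithLoops (x ∷ y ∷ ys)) ≡ msize M
    same-size = trans (msize-pathWithLoops x (y ∷ ys) (x∉ ∷ unique))
                      (sym (trans (msize-cong agrees) (msize-pathWithLoops y ys unique)))

  degree≡edgeDeg : ∀ z → degree G z ≡ edgeDeg (adj G) z
  degree≡edgeDeg z = trans (sum-allFin (λ v → 𝟙 (adj G z v))) (sum-cong-≗ (λ v → by-cases v (z ≟ v)))
    where
    by-cases : ∀ v → Dec (z ≡ v) → 𝟙 (adj G z v) ≡ nbr (adj G) z v
    by-cases v (yes refl) = trans (cong 𝟙 (SimpleGraph.irrefl G z)) (sym (nbr-refl (adj G) z))
    by-cases v (no z≢v) = sym (nbr-≢ (adj G) z≢v)

  unlooped-leaf⇒mdeg≤1 : {M : EdgeSetOf n} → IsEdgeSet T M → ∀ {x} → IsLeaf G x → M x x ≡ false → mdeg M x ≤ 1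
  unlooped-leaf⇒mdeg≤1 {M} M-edges {x} leaf unlooped = begin
    mdeg M x             ≡⟨ mdeg-noLoop M x unlooped ⟩
    edgeDeg M x          ≤⟨ sum-mono-≤ (nbr-mono {M = M} {adj G} (proj₂ M-edges x _)) ⟩
    edgeDeg (adj G) x    ≡⟨ degree≡edgeDeg x ⟨
    degree G x           ≡⟨ leaf ⟩
    1                    ∎
    where open ≤-Reasoning

  start-is-leaf : {M : EdgeSetOf n} {z p : Fin n} {rest : List (Fin n)} → IsMinimal2Matching T M →
    IsPath G (z ∷ p ∷ rest) → (∀ u v → M u v ≡ pathWithLoops (z ∷ p ∷ rest) u v) → IsLeaf G z
  start-is-leaf {z = z} {p} {rest} minimal path@(Azp ∷ linked , unique) agrees with other-neighbour? (adj G) z p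
  ... | inj₁ (x , _ , x≢p , Azx) = ⊥-elim (extendable⇒not-minimal agrees
        (Adj-sym G Azx ∷ Azp ∷ linked ,
         ∉ᵇ⇒All≢ (z ∷ p ∷ rest) (neighbour-of-start-∉ᵇ T rest path Azx x≢p) ∷ unique)
        minimal)
  ... | inj₂ only-p =
    trans (degree≡edgeDeg z) (≤-antisym (edgeDeg≤1 (adj G) only-p) (edgeDeg-pos (adj G) (Adj-irrefl G Azp) Azp))

  has-neighbour : 2 ≤ n → ∀ a → ∃ λ x → Adj G a x
  has-neighbour 2≤n a with other-vertex 2≤n a
  ... | b , b≢a with connected T a b
  ...   | a ∷ [] , _ , refl , a≡b = ⊥-elim (b≢a (sym (just-injective a≡b)))
  ...   | a ∷ x ∷ _ , (Aax ∷ _ , _) , refl , _ = x , Aax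

  low-degree-vertex : {M : EdgeSetOf n} → Fin n → Is2Matching T M → msize M ≡ n ∸ 1 → ∃ λ a → mdeg M a ≤ 1
  low-degree-vertex {M} a (M-edges , _) size with any? (λ a → mdeg M a ≤? 1)
  ... | yes found = found
  ... | no none = ⊥-elim (<⇒≱ sum<2n 2n≤sum)
    where
    2n≤sum : n * 2 ≤ sum (mdeg M)
    2n≤sum = subst (_≤ sum (mdeg M)) (sum-const {n} 2) (sum-mono-≤ (λ a → ≰⇒> (λ deg≤1 → none (a , deg≤1))))
    sum<2n : sum (mdeg M) < n * 2
    sum<2n = subst (sum (mdeg M) <_) (double-pred a) (subst (_< 2 * (n ∸ 1) + 1 + 1)
      (sym (trans (handshake M (proj₁ M-edges)) (cong (2 *_) size))) (≤-trans (m<m+n _ (s≤s z≤n)) (m≤m+n _ 1)))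

  LeafToLeafPathWithLoops : EdgeSetOf n → Set
  LeafToLeafPathWithLoops M = Σ (Fin n) λ u → Σ (Fin n) λ v → Σ (List (Fin n)) λ ps →
    IsLeaf G u × IsLeaf G v × u ≢ v × PathFromTo G u v ps × (∀ a b → M a b ≡ pathWithLoops ps a b)

  module _ {M : EdgeSetOf n} (minimal : IsMinimal2Matching T M) (size : msize M ≡ n ∸ 1) where

    private
      matching = proj₁ minimal

    -- start-is-leaf only sees the start of a path, so the path from a is rebuilt from its start z
    pendant⇒leaf-to-leaf : {a : Fin n} → mdeg M a ≡ 1 → LeafToLeafPathWithLoops M
    pendant⇒leaf-to-leaf deg-a = restart-at-start (pendant⇒path T matching size deg-a)
      where
      restart-at-start : ∀ {a} → PendantPath T matching size a → LeafToLeafPathWithLoops M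
      restart-at-start (pendantPath z p rest path _ agrees) = from-start (pendant⇒path T matching size deg-z)
        where
        deg-z : mdeg M z ≡ 1
        deg-z = trans (mdeg-cong agrees z) (mdeg-pathWithLoops-start z p rest (proj₂ path))
        from-start : PendantPath T matching size z → LeafToLeafPathWithLoops M
        from-start (pendantPath z′ p′ rest′ path′ z′⇝z agrees′) =
          z′ , z , z′ ∷ p′ ∷ rest′ , start-is-leaf minimal path′ agrees′ , start-is-leaf minimal path agrees ,
          subst (z′ ≢_) z′⇝z (start≢end rest′ (proj₂ path′)) ,
          (path′ , refl , trans (last-∷ z′ (p′ ∷ rest′)) (cong just z′⇝z)) , agrees′

  forward : 2 ≤ n → {M : EdgeSetOf n} → InV2* T (n ∸ 1) M → LeafToLeafPathWithLoops M
  forward 2≤n (minimal , size) with low-degree-vertex (vertex-of 2≤n) (proj₁ minimal) size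
  ... | a , deg≤1 with n≤1⇒n≡0∨n≡1 deg≤1
  ...   | inj₂ deg-a = pendant⇒leaf-to-leaf minimal size deg-a
  ...   | inj₁ deg-a with has-neighbour 2≤n a
  ...     | x , Aax = ⊥-elim (extendable⇒not-minimal (isolated⇒single-vertex-path T (proj₁ minimal) size deg-a)
                                (Adj-sym G Aax ∷ [-] , ((Adj-irrefl G Aax ∘ sym) ∷ []) ∷ [] ∷ []) minimal)

  module _ {u v y : Fin n} {ys : List (Fin n)} (leaf-u : IsLeaf G u) (leaf-v : IsLeaf G v)
           (path : IsPath G (u ∷ y ∷ ys)) (u⇝v : lastOf u (y ∷ ys) ≡ v) where

    private
      ps : List (Fin n)
      ps = u ∷ y ∷ ys
      P : EdgeSetOf n
      P = pathWithLoops ps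

    loops-within⇒pathWithLoops : {M′ : EdgeSetOf n} → Is2Matching T M′ → msize M′ ≡ n ∸ 1 →
      (∀ w → M′ w w ≡ true → P w w ≡ true) → ∀ a b → M′ a b ≡ P a b
    loops-within⇒pathWithLoops {M′} matching′ size′ loops⊆ =
      by-degree (n≤1⇒n≡0∨n≡1 (unlooped-leaf⇒mdeg≤1 M′-edges leaf-v (unlooped v∈ps)))
      where
      M′-edges = proj₁ matching′
      unlooped : ∀ {x} → x ∈ᵇ ps ≡ true → M′ x x ≡ false
      unlooped {x} x∈ps = ¬-not (λ M′xx → false≢true
        (trans (sym (trans (pathWithLoops-loop ps x) (cong not x∈ps))) (loops⊆ x M′xx)))
      u∈ps : u ∈ᵇ ps ≡ true
      u∈ps = ∈ᵇ-here u (y ∷ ys)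
      v∈ps : v ∈ᵇ ps ≡ true
      v∈ps = subst (λ l → l ∈ᵇ ps ≡ true) u⇝v (lastOf-∈ᵇ u (y ∷ ys))
      u≢v : u ≢ v
      u≢v = subst (u ≢_) u⇝v (start≢end ys (proj₂ path))
      deg-u≤1 : mdeg M′ u ≤ 1
      deg-u≤1 = unlooped-leaf⇒mdeg≤1 M′-edges leaf-u (unlooped u∈ps)
      from-pendant-path : PendantPath T matching′ size′ v → ∀ a b → M′ a b ≡ P a b
      from-pendant-path (pendantPath z p rest path′ z⇝v agrees′) a b =
        trans (agrees′ a b) (cong (λ r → pathWithLoops r a b) same-path)
        where
        start-at-u : Dec (u ≡ z) → u ≡ z
        start-at-u (yes u≡z) = u≡z
        start-at-u (no u≢z) = ⊥-elim (1+n≰n (subst (_≤ 1) (trans (mdeg-cong agrees′ u)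
          (mdeg-pathWithLoops-inner z (p ∷ rest) (proj₂ path′) u≢z (subst (u ≢_) (sym z⇝v) u≢v))) deg-u≤1))
        same-path : z ∷ p ∷ rest ≡ ps
        same-path = path-unique T ps (z ∷ p ∷ rest) path′ path (cong just (sym (start-at-u (u ≟ z))))
          (trans (last-∷ z (p ∷ rest)) (trans (cong just (trans z⇝v (sym u⇝v))) (sym (last-∷ u (y ∷ ys)))))
      by-degree : mdeg M′ v ≡ 0 ⊎ mdeg M′ v ≡ 1 → ∀ a b → M′ a b ≡ P a b
      by-degree (inj₁ deg-v) = ⊥-elim (false≢true (trans (sym (unlooped u∈ps))
        (trans (isolated⇒single-vertex-path T matching′ size′ deg-v u u)
          (trans (pathWithLoops-loop (v ∷ []) u) (cong not (∈ᵇ-∷-≢ [] (u≢v ∘ sym)))))))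
      by-degree (inj₂ deg-v) = from-pendant-path (pendant⇒path T matching′ size′ deg-v)

  backward : {M : EdgeSetOf n} → IsEdgeSet T M → LeafToLeafPathWithLoops M → InV2* T (n ∸ 1) M
  backward _ (_ , _ , [] , _ , _ , _ , (_ , () , _) , _)
  backward _ (_ , _ , _ ∷ [] , _ , _ , u≢v , (_ , refl , u≡v) , _) = ⊥-elim (u≢v (just-injective u≡v))
  backward {M} M-edges (u , v , .u ∷ y ∷ ys , leaf-u , leaf-v , _ , (path , refl , ends) , agrees) =
    (matching , minimal) , size
    where
    ps : List (Fin n)
    ps = u ∷ y ∷ ys
    u⇝v : lastOf u (y ∷ ys) ≡ v
    u⇝v = just-injective (trans (sym (last-∷ u (y ∷ ys))) ends)
    matching : Is2Matching T M
    matching = M-edges , λ w → subst (_≤ 2) (sym (mdeg-cong agrees w)) (proj₂ (pathWithLoops-2matching path) w)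
    size : msize M ≡ n ∸ 1
    size = trans (msize-cong agrees) (msize-pathWithLoops u (y ∷ ys) (proj₂ path))
    minimal : ¬ (Σ (EdgeSetOf n) λ M′ → Is2Matching T M′ × LoopsStrictSub T M′ M × msize M′ ≡ msize M)
    minimal (M′ , matching′ , (loops⊆ , w , Mww , M′ww) , same-size) = false≢true (begin
      false                  ≡⟨ M′ww ⟨
      M′ w w                 ≡⟨ loops-within⇒pathWithLoops leaf-u leaf-v path u⇝v matching′ (trans same-size size)
                                  (λ x M′xx → trans (sym (agrees x x)) (loops⊆ x M′xx)) w w ⟩
      pathWithLoops ps w w   ≡⟨ agrees w w ⟨
      M w w                  ≡⟨ Mww ⟩
      true                   ∎)
      where open ≡-Reasoning

proposition4p9 : (n : ℕ) → 2 ≤ n → (T : Tree n) → (M : EdgeSetOf n) → IsEdgeSet T M →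
    (InV2* T (n ∸ 1) M ⇔
      (Σ (Fin n) λ u → Σ (Fin n) λ v → Σ (List (Fin n)) λ ps →
        IsLeaf (graph T) u × IsLeaf (graph T) v × u ≢ v × PathFromTo (graph T) u v ps
        × (∀ a b → M a b ≡ pathWithLoops ps a b)))
proposition4p9 n 2≤n T M M-edges = mk⇔ (forward T 2≤n) (backward T M-edges)
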